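{- If $L$ is a finite semidistrim lattice, then $|\{x\in L:\mathsf{Row}_L(x)\le x\}|=|\mathsf{Pop}^\downarrow_L(L)|=|\mathsf{Pop}^\uparrow_L(L)|$.
   Context: All lattices are finite. For a lattice $L$, $\mathcal{J}_L$ (resp. $\mathcal{M}_L$) is the set of join-irreducible (resp. meet-irreducible) elements; for $j\in\mathcal{J}_L$, $j_*$ is the unique element covered by $j$, and for $m\in\mathcal{M}_L$, $m^*$ is the unique element covering $m$. Let $\mathcal{M}_L(j)=\max\{z\in L: j_*=j\wedge z\}$ and $\mathcal{J}_L(m)=\min\{z\in L: m^*=m\vee z\}$. A pairing on $L$ is a bijection $\kappa:\mathcal{J}_L\to\mathcal{M}_L$ with $\kappa(j)\in\mathcal{M}_L(j)$ for all $j$ and $\kappa^{ -1}(m)\in\mathcal{J}_L(m)$ for all $m$; $L$ is uniquely paired if it has exactly one pairing, denoted $\kappa_L$. A prime pair is a pair $(j_0,m_0)$ with $L=[\hat0,m_0]\sqcup[j_0,\hat1]$. A uniquely paired lattice $L$ is compatibly dismantlable if $|L|=1$ or there is a prime pair $(j_0,m_0)$ such that: (i) $[j_0,\hat1]$ is compatibly dismantlable and $\alpha(j)=j_0\vee j$ defines a bijection $\{j\in\mathcal{J}_L: j_0\le\kappa_L(j)\}\to\mathcal{J}_{[j_0,\hat1]}$ with $\kappa_{[j_0,\hat1]}(\alpha(j))=\kappa_L(j)$; (ii) $[\hat0,m_0]$ is compatibly dismantlable and $\beta(m)=m_0\wedge m$ defines a bijection $\{m\in\mathcal{M}_L:\kappa_L^{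 -1}(m)\le m_0\}\to\mathcal{M}_{[\hat0,m_0]}$ with $\kappa_{[\hat0,m_0]}^{ -1}(\beta(m))=\kappa_L^{ -1}(m)$. The Galois graph $G_L$ is the directed graph on $\mathcal{J}_L$ with an edge $j\to j'$ iff $j\ne j'$ and $j\not\le\kappa_L(j')$. For $x\in L$ let $J_L(x)=\{j\in\mathcal{J}_L:j\le x\}$ and $M_L(x)=\{j\in\mathcal{J}_L:\kappa_L(j)\ge x\}$. For a compatibly dismantlable $L$, for every cover $x\lessdot y$ the set $M_L(x)\cap J_L(y)$ has exactly one element $j_{xy}$; set $\mathcal{D}_L(x)=\{j_{yx}:y\lessdot x\}$ and $\mathcal{U}_L(x)=\{j_{xy}:x\lessdot y\}$. $L$ is semidistrim if it is compatibly dismantlable and $\mathcal{D}_L(x)$, $\mathcal{U}_L(x)$ are independent sets (no two elements adjacent) of $G_L$ for all $x\in L$. For semidistrim $L$, the maps $\mathcal{D}_L$ and $\mathcal{U}_L$ are bijections from $L$ to the set of independent sets of $G_L$, and rowmotion $\mathsf{Row}_L:L\to L$ is the bijection defined by $\mathcal{U}_L(\mathsf{Row}_L(x))=\mathcal{D}_L(x)$. $\mathsf{Pop}^\downarrow_L(x)=x\wedge\bigwedge\{y:y\lessdot x\}$ and $\mathsf{Pop}^\uparrow_L(x)=x\vee\bigvee\{y:x\lessdot y\}$; $\mathsf{Pop}^\downarrow_L(L)$ and $\mathsf{Pop}^\uparrow_L(L)$ denote their images. -}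

module Defs where

open import Data.Nat using (ℕ)
import Level
open import Data.Bool using (Bool; T)
open import Data.Fin using (Fin; _≟_)
open import Data.Fin.Properties using (any?; all?)
open import Data.List using (List; foldr; filter; length)
open import Data.List.Base using (allFin)
open import Data.Product using (Σ; ∃; _×_; _,_)
open import Data.Sum using (_⊎_)
open import Relation.Nullary using (¬_; Dec)
open import Relation.Nullary.Decidable using (_×-dec_; _⊎-dec_; _→-dec_; ¬?; T?)
open import Relation.Unary using (Pred; Decidable)
open import Relation.Binary.PropositionalEquality using (_≡_; _≢_)
open import Relation.Binary.Lattice.Structures using (IsBoundedLattice)

record FinLattice : Set where
  field
    n   : ℕ
    le  : Fin n → Fin n → Bool
    _∨_ : Fin n → Fin n → Fin n
    _∧_ : Fin n → Fin n → Fin n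
    ⊤   : Fin n
    ⊥   : Fin n
    isBoundedLattice :
      IsBoundedLattice _≡_ (λ x y → T (le x y)) _∨_ _∧_ ⊤ ⊥

module FL (L : FinLattice) where
  open FinLattice L public

  C : Set
  C = Fin n

  infix 4 _≤_ _<_ _⋖_

  _≤_ : C → C → Set
  x ≤ y = T (le x y)

  _<_ : C → C → Set
  x < y = x ≤ y × x ≢ y

  _⋖_ : C → C → Set
  x ⋖ y = x < y × (∀ z → x ≤ z → z ≤ y → z ≡ x ⊎ z ≡ y)

  _≤?_ : (x y : C) → Dec (x ≤ y)
  x ≤? y = T? (le x y)

  _⋖?_ : (x y : C) → Dec (x ⋖ y)
  x ⋖? y = ((x ≤? y) ×-dec ¬? (x ≟ y))
           ×-dec all? (λ z → (x ≤? z) →-dec ((z ≤? y) →-dec ((z ≟ x) ⊎-dec (z ≟ y))))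

  count : {P : Pred C Level.zero} → Decidable P → ℕ
  count P? = length (filter P? (allFin n))

  imageSize : (C → C) → ℕ
  imageSize f = count (λ y → any? (λ x → f x ≟ y))

  -- Notions relative to an interval [a , b] of L (intervals of intervals
  -- are intervals of L; covers, meets and joins are inherited).

  InI : C → C → C → Set
  InI a b x = a ≤ x × x ≤ b

  LowerCover : C → C → C → C → Set
  LowerCover a b j js = InI a b js × js ⋖ j × (∀ y → InI a b y → y ⋖ j → y ≡ js)

  UpperCover : C → C → C → C → Set
  UpperCover a b m ms = InI a b ms × m ⋖ ms × (∀ y → InI a b y → m ⋖ y → y ≡ ms)

  JI : C → C → C → Set
  JI a b j = InI a b j × ∃ (LowerCover a b j)

  MI : C → C → C → Set
  MI a b m = InI a b m × ∃ (UpperCover a b m)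

  InMset : C → C → C → C → Set
  InMset a b j z = ∀ js → LowerCover a b j js →
    InI a b z × js ≡ (j ∧ z) × (∀ w → InI a b w → z < w → js ≢ (j ∧ w))

  InJset : C → C → C → C → Set
  InJset a b m z = ∀ ms → UpperCover a b m ms →
    InI a b z × ms ≡ (m ∨ z) × (∀ w → InI a b w → w < z → ms ≢ (m ∨ w))

  -- κ is a pairing on [a,b] (only its values on join-irreducibles matter)
  record IsPairing (a b : C) (κ : C → C) : Set where
    field
      maps-to    : ∀ j → JI a b j → MI a b (κ j)
      injective  : ∀ j j' → JI a b j → JI a b j' → κ j ≡ κ j' → j ≡ j'
      surjective : ∀ m → MI a b m → ∃ λ j → JI a b j × κ j ≡ m
      κ∈𝓜        : ∀ j → JI a b j → InMset a b j (κ j)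
      κ⁻¹∈𝓙      : ∀ j → JI a b j → InJset a b (κ j) j

  record UniquelyPaired (a b : C) : Set where
    field
      κ         : C → C
      isPairing : IsPairing a b κ
      unique    : ∀ κ' → IsPairing a b κ' → ∀ j → JI a b j → κ' j ≡ κ j

  PrimePair : C → C → C → C → Set
  PrimePair a b j0 m0 = InI a b j0 × InI a b m0 ×
    (∀ x → InI a b x → (x ≤ m0 × ¬ (j0 ≤ x)) ⊎ (¬ (x ≤ m0) × j0 ≤ x))

  record CondI (a b j0 : C) (up : UniquelyPaired a b)
               (upU : UniquelyPaired j0 b) : Set where
    private
      κ  = UniquelyPaired.κ up
      κ' = UniquelyPaired.κ upU
      Dom : C → Set
      Dom j = JI a b j × j0 ≤ κ j
    field
      maps-to    : ∀ j → Dom j → JI j0 b (j0 ∨ j) × κ' (j0 ∨ j) ≡ κ j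
      injective  : ∀ j j' → Dom j → Dom j' → (j0 ∨ j) ≡ (j0 ∨ j') → j ≡ j'
      surjective : ∀ j' → JI j0 b j' → ∃ λ j → Dom j × (j0 ∨ j) ≡ j'

  record CondII (a b m0 : C) (up : UniquelyPaired a b)
                (upD : UniquelyPaired a m0) : Set where
    private
      κ  = UniquelyPaired.κ up
      κ' = UniquelyPaired.κ upD
      IsInv : C → C → Set
      IsInv m j = JI a b j × κ j ≡ m
      Dom : C → Set
      Dom m = MI a b m × ∃ λ j → IsInv m j × j ≤ m0
    field
      maps-to    : ∀ m → Dom m → MI a m0 (m0 ∧ m) ×
                     (∀ j → IsInv m j → JI a m0 j × κ' j ≡ (m0 ∧ m))
      injective  : ∀ m m' → Dom m → Dom m' → (m0 ∧ m) ≡ (m0 ∧ m') → m ≡ m'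
      surjective : ∀ m' → MI a m0 m' → ∃ λ m → Dom m × (m0 ∧ m) ≡ m'

  data CD : (a b : C) → UniquelyPaired a b → Set where
    single    : ∀ {a b} (up : UniquelyPaired a b) → a ≡ b → CD a b up
    dismantle : ∀ {a b} (up : UniquelyPaired a b) (j0 m0 : C) →
                PrimePair a b j0 m0 →
                (upU : UniquelyPaired j0 b) → CD j0 b upU →
                (upD : UniquelyPaired a m0) → CD a m0 upD →
                CondI a b j0 up upU → CondII a b m0 up upD →
                CD a b up

  module WithPairing (κ : C → C) where
    𝓙 : C → Set
    𝓙 = JI ⊥ ⊤

    Edge : C → C → Set
    Edge j j' = 𝓙 j × 𝓙 j' × j ≢ j' × ¬ (j ≤ κ j')

    J_ : C → C → Set
    J_ x j = 𝓙 j × j ≤ x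

    M_ : C → C → Set
    M_ x j = 𝓙 j × x ≤ κ j

    -- 𝓓(x) = { j_{yx} : y ⋖ x },  𝓤(x) = { j_{xy} : x ⋖ y }
    𝓓 : C → C → Set
    𝓓 x j = ∃ λ y → y ⋖ x × M_ y j × J_ x j

    𝓤 : C → C → Set
    𝓤 x j = ∃ λ y → x ⋖ y × M_ x j × J_ y j

    Independent : (C → Set) → Set
    Independent S = ∀ j j' → S j → S j' → ¬ Edge j j'

  record Semidistrim : Set where
    field
      up : UniquelyPaired ⊥ ⊤
      cd : CD ⊥ ⊤ up
    open WithPairing (UniquelyPaired.κ up)
    field
      𝓓-indep : ∀ x → Independent (𝓓 x)
      𝓤-indep : ∀ x → Independent (𝓤 x)

  IsRowmotion : Semidistrim → (C → C) → Set
  IsRowmotion sd Row = ∀ x j → (𝓤 (Row x) j → 𝓓 x j) × (𝓓 x j → 𝓤 (Row x) j)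
    where open WithPairing (UniquelyPaired.κ (Semidistrim.up sd))

  Pop↓ : C → C
  Pop↓ x = x ∧ foldr _∧_ ⊤ (filter (λ y → y ⋖? x) (allFin n))

  Pop↑ : C → C
  Pop↑ x = x ∨ foldr _∨_ ⊥ (filter (λ y → x ⋖? y) (allFin n))

-- Every cover y ⋖ x of a compatibly dismantlable lattice has a label j ∈ 𝓙 with j ≤ x and
-- y ≤ κ j, and for j ∈ 𝓙 and t ≤ κ j (resp. j ≤ t) the element (t ∨ j) ∧ κ j is covered by
-- t ∨ j (resp. t ∧ κ j by (t ∧ κ j) ∨ j); all three follow by induction along the dismantling.
-- In a semidistrim lattice the labels make x the join of 𝓓(x) and the meet of κ(𝓤(x)), so
-- rowmotion is injective, and with independence they give 𝓓(x) ⊆ 𝓤(Pop↓ x) and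
-- 𝓤(x) ⊆ 𝓓(Pop↑ x). Consequently Row x ≤ x forces Row x = Pop↓ x and Pop↑ (Row x) = x, every
-- Pop↓-image is Row w for some w with Row w ≤ w, and every Pop↑-image u has Row u ≤ u. So Row
-- maps {x : Row x ≤ x} bijectively onto Pop↓(L), and that set is exactly Pop↑(L).

module Submission where

open import Defs
open import Level using (0ℓ)
open import Data.Nat as ℕ using (ℕ; suc)
import Data.Nat.Properties as ℕ
open import Data.Empty using (⊥-elim)
open import Data.Fin using (Fin; _≟_; punchOut)
open import Data.Fin.Properties using (any?; injective⇒≤; punchOut-injective)
open import Data.Fin.Induction using (po-wellFounded; po-noetherian)
open import Data.List using (List; []; _∷_; foldr; filter; length; lookup; allFin)
open import Data.List.Properties using (filter-≐)
open import Data.List.Relation.Unary.Any as Any using (here; there)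
open import Data.List.Relation.Unary.Any.Properties using (lookup-index)
import Data.List.Relation.Unary.All as All
import Data.List.Relation.Unary.AllPairs as AllPairs
open import Data.List.Membership.Propositional using (_∈_)
open import Data.List.Membership.Propositional.Properties
  using (∈-filter⁺; ∈-filter⁻; ∈-allFin; ∈-lookup)
open import Data.List.Relation.Unary.Unique.Propositional using (Unique)
open import Data.List.Relation.Unary.Unique.Propositional.Properties using (allFin⁺; filter⁺)
open import Data.Product using (∃; _×_; _,_; proj₁; proj₂)
open import Data.Sum using (_⊎_; inj₁; inj₂)
open import Function using (flip; _∘_)
open import Function.Definitions using (Injective)
open import Induction.WellFounded using (Acc; acc)
open import Relation.Nullary using (¬_; Dec; yes; no; contradiction)
open import Relation.Nullary.Decidable using (_×-dec_; ¬?)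
open import Relation.Unary using (Pred; Decidable; _≐_)
open import Relation.Binary.PropositionalEquality
  using (_≡_; _≢_; refl; sym; trans; cong; cong₂; subst; module ≡-Reasoning)
open import Relation.Binary.Lattice.Structures using (IsBoundedLattice)

-- Counting on Fin n

countFin : ∀ {n} {P : Pred (Fin n) 0ℓ} → Decidable P → ℕ
countFin {n} P? = length (filter P? (allFin n))

countFin-cong : ∀ {n} {P Q : Pred (Fin n) 0ℓ} (P? : Decidable P) (Q? : Decidable Q) →
  P ≐ Q → countFin P? ≡ countFin Q?
countFin-cong {n} P? Q? P≐Q = cong length (filter-≐ P? Q? P≐Q (allFin n))

lookup-injective : ∀ {A : Set} {xs : List A} → Unique xs →
  ∀ {i j} → lookup xs i ≡ lookup xs j → i ≡ j
lookup-injective (_ AllPairs.∷ _) {Fin.zero} {Fin.zero} _ = refl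
lookup-injective (x∉xs AllPairs.∷ _) {Fin.zero} {Fin.suc j} eq =
  contradiction eq (All.lookup x∉xs (∈-lookup j))
lookup-injective (x∉xs AllPairs.∷ _) {Fin.suc i} {Fin.zero} eq =
  contradiction (sym eq) (All.lookup x∉xs (∈-lookup i))
lookup-injective (_ AllPairs.∷ unique) {Fin.suc i} {Fin.suc j} eq =
  cong Fin.suc (lookup-injective unique eq)

countFin-≤-injection : ∀ {n} {P Q : Pred (Fin n) 0ℓ} (P? : Decidable P) (Q? : Decidable Q)
  (f : Fin n → Fin n) → (∀ {x} → P x → Q (f x)) →
  (∀ {x y} → P x → P y → f x ≡ f y → x ≡ y) → countFin P? ℕ.≤ countFin Q?
countFin-≤-injection {n} {P} P? Q? f f-maps f-inj = injective⇒≤ index-injective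
  where
  xs = filter P? (allFin n)
  ys = filter Q? (allFin n)
  P-lookup : ∀ i → P (lookup xs i)
  P-lookup i = proj₂ (∈-filter⁻ P? {xs = allFin n} (∈-lookup i))
  image∈ys : ∀ i → f (lookup xs i) ∈ ys
  image∈ys i = ∈-filter⁺ Q? (∈-allFin _) (f-maps (P-lookup i))
  index-injective : Injective _≡_ _≡_ (λ i → Any.index (image∈ys i))
  index-injective {i} {j} eq =
    lookup-injective (filter⁺ P? (allFin⁺ n)) (f-inj (P-lookup i) (P-lookup j) f-lookup-eq)
    where
    open ≡-Reasoning
    f-lookup-eq : f (lookup xs i) ≡ f (lookup xs j)
    f-lookup-eq = begin
      f (lookup xs i)                    ≡⟨ lookup-index (image∈ys i) ⟩
      lookup ys (Any.index (image∈ys i)) ≡⟨ cong (lookup ys) eq ⟩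
      lookup ys (Any.index (image∈ys j)) ≡⟨ lookup-index (image∈ys j) ⟨
      f (lookup xs j)                    ∎

injective⇒surjective : ∀ {m} (f : Fin m → Fin m) → Injective _≡_ _≡_ f → ∀ y → ∃ λ x → f x ≡ y
injective⇒surjective {suc m} f f-inj y with any? (λ x → f x ≟ y)
... | yes hit = hit
... | no miss = contradiction (injective⇒≤ g-injective) ℕ.1+n≰n
  where
  g : Fin (suc m) → Fin m
  g x = punchOut {i = y} {j = f x} (λ y≡fx → miss (x , sym y≡fx))
  g-injective : Injective _≡_ _≡_ g
  g-injective {x} {x'} eq =
    f-inj (punchOut-injective (λ e → miss (x , sym e)) (λ e → miss (x' , sym e)) eq)

module LatticeTheory (L : FinLattice) where
  open FL L

  private module BL = IsBoundedLattice isBoundedLattice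
  open BL using (isPartialOrder; antisym; reflexive; ∨-least; ∧-greatest)
    renaming (refl to ≤-refl; trans to ≤-trans)

  x≤x∨y : ∀ {x y} → x ≤ x ∨ y
  x≤x∨y = BL.x≤x∨y _ _

  y≤x∨y : ∀ {x y} → y ≤ x ∨ y
  y≤x∨y = BL.y≤x∨y _ _

  x∧y≤x : ∀ {x y} → x ∧ y ≤ x
  x∧y≤x = BL.x∧y≤x _ _

  x∧y≤y : ∀ {x y} → x ∧ y ≤ y
  x∧y≤y = BL.x∧y≤y _ _

  x≤⊤ : ∀ {x} → x ≤ ⊤
  x≤⊤ = BL.maximum _

  ⊥≤x : ∀ {x} → ⊥ ≤ x
  ⊥≤x = BL.minimum _

  x≤y⇒x∧y≡x : ∀ {x y} → x ≤ y → x ∧ y ≡ x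
  x≤y⇒x∧y≡x x≤y = antisym x∧y≤x (∧-greatest ≤-refl x≤y)

  ≰⇒<∨ : ∀ {v w} → ¬ v ≤ w → w < v ∨ w
  ≰⇒<∨ v≰w = y≤x∨y , λ w≡v∨w → v≰w (subst (_ ≤_) (sym w≡v∨w) x≤x∨y)

  ≰⇒∧< : ∀ {w v} → ¬ w ≤ v → w ∧ v < w
  ≰⇒∧< w≰v = x∧y≤x , λ w∧v≡w → w≰v (subst (_≤ _) w∧v≡w x∧y≤y)

  inI-⊥⊤ : ∀ x → InI ⊥ ⊤ x
  inI-⊥⊤ x = ⊥≤x , x≤⊤

  inI-degenerate : ∀ {a b x y} → a ≡ b → InI a b x → InI a b y → x ≡ y
  inI-degenerate refl (a≤x , x≤a) (a≤y , y≤a) = trans (antisym x≤a a≤x) (antisym a≤y y≤a)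

  ⋖⇒≤ : ∀ {x y} → x ⋖ y → x ≤ y
  ⋖⇒≤ ((x≤y , _) , _) = x≤y

  ⋖⇒≢ : ∀ {x y} → x ⋖ y → x ≢ y
  ⋖⇒≢ ((_ , x≢y) , _) = x≢y

  ⋖-resp-≡ : ∀ {x x' y y'} → x ≡ x' → y ≡ y' → x ⋖ y → x' ⋖ y'
  ⋖-resp-≡ refl refl x⋖y = x⋖y

  _<?_ : (x y : C) → Dec (x < y)
  x <? y = (x ≤? y) ×-dec ¬? (x ≟ y)

  Between : C → C → Set
  Between x y = ∃ λ z → x < z × z < y

  between? : ∀ x y → Dec (Between x y)
  between? x y = any? (λ z → (x <? z) ×-dec (z <? y))

  ⋖-intro : ∀ {x y} → x < y → ¬ Between x y → x ⋖ y
  ⋖-intro {x} {y} x<y empty = x<y , middle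
    where
    middle : ∀ z → x ≤ z → z ≤ y → z ≡ x ⊎ z ≡ y
    middle z x≤z z≤y with z ≟ x | z ≟ y
    ... | yes z≡x | _       = inj₁ z≡x
    ... | no _    | yes z≡y = inj₂ z≡y
    ... | no z≢x  | no z≢y  = contradiction (z , (x≤z , z≢x ∘ sym) , (z≤y , z≢y)) empty

  lowerCover-above : ∀ {x y} → x < y → ∃ λ c → x ≤ c × c ⋖ y
  lowerCover-above {x} {y} = go (po-noetherian isPartialOrder x)
    where
    go : ∀ {x} → Acc (flip _<_) x → x < y → ∃ λ c → x ≤ c × c ⋖ y
    go {x} (acc rec) x<y with between? x y
    ... | no empty = x , ≤-refl , ⋖-intro x<y empty
    ... | yes (z , x<z , z<y) with go (rec x<z) z<y
    ...   | c , z≤c , c⋖y = c , ≤-trans (proj₁ x<z) z≤c , c⋖y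

  upperCover-below : ∀ {x y} → x < y → ∃ λ c → x ⋖ c × c ≤ y
  upperCover-below {x} {y} = go (po-wellFounded isPartialOrder y)
    where
    go : ∀ {y} → Acc _<_ y → x < y → ∃ λ c → x ⋖ c × c ≤ y
    go {y} (acc rec) x<y with between? x y
    ... | no empty = y , ⋖-intro x<y empty , ≤-refl
    ... | yes (z , x<z , z<y) with go (rec z<y) x<z
    ...   | c , x⋖c , c≤z = c , x⋖c , ≤-trans c≤z (proj₁ z<y)

  ⋖-by-lowerCovers : ∀ {z s} → z < s → (∀ y → z ≤ y → y ⋖ s → y ≤ z) → z ⋖ s
  ⋖-by-lowerCovers z<s below with lowerCover-above z<s
  ... | y , z≤y , y⋖s = ⋖-resp-≡ (antisym (below y z≤y y⋖s) z≤y) refl y⋖s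

  ⋖-by-upperCovers : ∀ {r u} → r < u → (∀ c → r ⋖ c → c ≤ u → u ≤ c) → r ⋖ u
  ⋖-by-upperCovers r<u above with upperCover-below r<u
  ... | c , r⋖c , c≤u = ⋖-resp-≡ refl (antisym c≤u (above c r⋖c c≤u)) r⋖c

  ⋖-join : ∀ {y x j} → y ⋖ x → j ≤ x → ¬ j ≤ y → y ∨ j ≡ x
  ⋖-join {y} {x} {j} (y<x , middle) j≤x j≰y with middle (y ∨ j) x≤x∨y (∨-least (proj₁ y<x) j≤x)
  ... | inj₁ y∨j≡y = contradiction (≤-trans y≤x∨y (reflexive y∨j≡y)) j≰y
  ... | inj₂ y∨j≡x = y∨j≡x

  ⋖-meet : ∀ {y x m} → y ⋖ x → y ≤ m → ¬ x ≤ m → x ∧ m ≡ y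
  ⋖-meet {y} {x} {m} (y<x , middle) y≤m x≰m with middle (x ∧ m) (∧-greatest (proj₁ y<x) y≤m) x∧y≤x
  ... | inj₁ x∧m≡y = x∧m≡y
  ... | inj₂ x∧m≡x = contradiction (≤-trans (reflexive (sym x∧m≡x)) x∧y≤y) x≰m

  foldr-∧-≤ : ∀ {y ys} → y ∈ ys → foldr _∧_ ⊤ ys ≤ y
  foldr-∧-≤ (here refl) = x∧y≤x
  foldr-∧-≤ (there y∈ys) = ≤-trans x∧y≤y (foldr-∧-≤ y∈ys)

  foldr-∧-greatest : ∀ {v} ys → (∀ {y} → y ∈ ys → v ≤ y) → v ≤ foldr _∧_ ⊤ ys
  foldr-∧-greatest [] _ = x≤⊤
  foldr-∧-greatest (y ∷ ys) v≤ = ∧-greatest (v≤ (here refl)) (foldr-∧-greatest ys (v≤ ∘ there))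

  ≤-foldr-∨ : ∀ {y ys} → y ∈ ys → y ≤ foldr _∨_ ⊥ ys
  ≤-foldr-∨ (here refl) = x≤x∨y
  ≤-foldr-∨ (there y∈ys) = ≤-trans (≤-foldr-∨ y∈ys) y≤x∨y

  foldr-∨-least : ∀ {v} ys → (∀ {y} → y ∈ ys → y ≤ v) → foldr _∨_ ⊥ ys ≤ v
  foldr-∨-least [] _ = ⊥≤x
  foldr-∨-least (y ∷ ys) ≤v = ∨-least (≤v (here refl)) (foldr-∨-least ys (≤v ∘ there))

  Pop↓-≤ : ∀ {x} → Pop↓ x ≤ x
  Pop↓-≤ = x∧y≤x

  Pop↓-≤-lowerCover : ∀ {x y} → y ⋖ x → Pop↓ x ≤ y
  Pop↓-≤-lowerCover {x} {y} y⋖x =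
    ≤-trans x∧y≤y (foldr-∧-≤ (∈-filter⁺ (_⋖? x) (∈-allFin y) y⋖x))

  Pop↓-greatest : ∀ {x v} → v ≤ x → (∀ y → y ⋖ x → v ≤ y) → v ≤ Pop↓ x
  Pop↓-greatest {x} v≤x v≤covers = ∧-greatest v≤x (foldr-∧-greatest _ λ y∈ →
    v≤covers _ (proj₂ (∈-filter⁻ (_⋖? x) {xs = allFin n} y∈)))

  ≤-Pop↑ : ∀ {x} → x ≤ Pop↑ x
  ≤-Pop↑ = x≤x∨y

  upperCover-≤-Pop↑ : ∀ {x y} → x ⋖ y → y ≤ Pop↑ x
  upperCover-≤-Pop↑ {x} {y} x⋖y =
    ≤-trans (≤-foldr-∨ (∈-filter⁺ (x ⋖?_) (∈-allFin y) x⋖y)) y≤x∨y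

  Pop↑-least : ∀ {x v} → x ≤ v → (∀ y → x ⋖ y → y ≤ v) → Pop↑ x ≤ v
  Pop↑-least {x} x≤v covers≤v = ∨-least x≤v (foldr-∨-least _ λ y∈ →
    covers≤v _ (proj₂ (∈-filter⁻ (x ⋖?_) {xs = allFin n} y∈)))

  -- Compatibly dismantlable intervals

  j≰κj : ∀ {a b κ} → IsPairing a b κ → ∀ {j} → JI a b j → ¬ j ≤ κ j
  j≰κj pairing j-JI@(_ , j* , j*-cover) j≤κj with IsPairing.κ∈𝓜 pairing _ j-JI j* j*-cover
  ... | _ , j*≡j∧κj , _ = ⋖⇒≢ (proj₁ (proj₂ j*-cover)) (trans j*≡j∧κj (x≤y⇒x∧y≡x j≤κj))

  no-JI-in-point : ∀ {a b j} → a ≡ b → ¬ JI a b j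
  no-JI-in-point a≡b (inI-j , _ , inI-j* , j*⋖j , _) = ⋖⇒≢ j*⋖j (inI-degenerate a≡b inI-j* inI-j)

  module _ {a b : C} (up : UniquelyPaired a b) where
    private
      κ = UniquelyPaired.κ up

    -- j is the label j_{yx} of the cover.
    CoverLabelling : Set
    CoverLabelling = ∀ y x → InI a b y → InI a b x → y ⋖ x →
      ∃ λ j → JI a b j × j ≤ x × y ≤ κ j

    JoinCoverProperty : Set
    JoinCoverProperty = ∀ j t → JI a b j → InI a b t → t ≤ κ j → (t ∨ j) ∧ κ j ⋖ t ∨ j

    MeetCoverProperty : Set
    MeetCoverProperty = ∀ j t → JI a b j → InI a b t → j ≤ t → t ∧ κ j ⋖ (t ∧ κ j) ∨ j

  module PrimePairSplit {a b : C} (up : UniquelyPaired a b) (j0 m0 : C) (pp : PrimePair a b j0 m0)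
         (upU : UniquelyPaired j0 b) (upD : UniquelyPaired a m0)
         (condI : CondI a b j0 up upU) (condII : CondII a b m0 up upD) where
    private
      κ = UniquelyPaired.κ up
      κU = UniquelyPaired.κ upU
      κD = UniquelyPaired.κ upD
      pairing = UniquelyPaired.isPairing up
      pairingD = UniquelyPaired.isPairing upD
      inI-j0 = proj₁ pp
      inI-m0 = proj₁ (proj₂ pp)
      a≤m0 = proj₁ inI-m0
      j0≤b = proj₂ inI-j0

    ≤m0-unless-j0≤ : ∀ {x} → InI a b x → ¬ j0 ≤ x → x ≤ m0
    ≤m0-unless-j0≤ inI-x j0≰x with proj₂ (proj₂ pp) _ inI-x
    ... | inj₁ (x≤m0 , _) = x≤m0
    ... | inj₂ (_ , j0≤x) = contradiction j0≤x j0≰x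

    j0≰m0 : ¬ j0 ≤ m0
    j0≰m0 with proj₂ (proj₂ pp) _ inI-j0
    ... | inj₁ (_ , j0≰j0) = contradiction ≤-refl j0≰j0
    ... | inj₂ (j0≰m0 , _) = j0≰m0

    lowerCover-j0-unique : ∀ {y} → InI a b y → y ⋖ j0 → y ≡ j0 ∧ m0
    lowerCover-j0-unique {y} inI-y y⋖j0 with j0 ≤? y
    ... | yes j0≤y = contradiction (antisym (⋖⇒≤ y⋖j0) j0≤y) (⋖⇒≢ y⋖j0)
    ... | no j0≰y = sym (⋖-meet y⋖j0 (≤m0-unless-j0≤ inI-y j0≰y) j0≰m0)

    a≢j0 : a ≢ j0
    a≢j0 a≡j0 = j0≰m0 (subst (_≤ m0) a≡j0 a≤m0)

    j0∧m0-lowerCover : LowerCover a b j0 (j0 ∧ m0)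
    j0∧m0-lowerCover with lowerCover-above (proj₁ inI-j0 , a≢j0)
    ... | y , a≤y , y⋖j0 =
      inI-j0∧m0 , ⋖-resp-≡ (lowerCover-j0-unique inI-y y⋖j0) refl y⋖j0 , λ _ → lowerCover-j0-unique
      where
      inI-y = a≤y , ≤-trans (⋖⇒≤ y⋖j0) j0≤b
      inI-j0∧m0 = ∧-greatest (proj₁ inI-j0) a≤m0 , ≤-trans x∧y≤x j0≤b

    j0-JI : JI a b j0
    j0-JI = inI-j0 , _ , j0∧m0-lowerCover

    κj0≡m0 : κ j0 ≡ m0
    κj0≡m0 with IsPairing.κ∈𝓜 pairing j0 j0-JI _ j0∧m0-lowerCover
    ... | inI-κj0 , _ , maximal with κ j0 ≟ m0
    ...   | yes κj0≡m0 = κj0≡m0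
    ...   | no κj0≢m0 = contradiction refl
            (maximal m0 inI-m0 (≤m0-unless-j0≤ inI-κj0 (j≰κj pairing j0-JI) , κj0≢m0))

    -- The unique lower cover of j lies above j0 and equals j ∧ κ j.
    j0≤κ : ∀ {j} → JI a b j → j0 ≤ j → j ≢ j0 → j0 ≤ κ j
    j0≤κ {j} j-JI@(inI-j , j* , j*-cover@(_ , _ , j*-unique)) j0≤j j≢j0
      with lowerCover-above (j0≤j , j≢j0 ∘ sym)
    ... | c , j0≤c , c⋖j with IsPairing.κ∈𝓜 pairing j j-JI j* j*-cover
    ...   | _ , j*≡j∧κj , _ = ≤-trans j0≤c (≤-trans (reflexive c≡j∧κj) x∧y≤y)
      where
      c≡j∧κj : c ≡ j ∧ κ j
      c≡j∧κj = trans (j*-unique c (≤-trans (proj₁ inI-j0) j0≤c , ≤-trans (⋖⇒≤ c⋖j) (proj₂ inI-j)) c⋖j)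
                     j*≡j∧κj

    κ-inI : ∀ {j} → JI a b j → InI a b (κ j)
    κ-inI {j} j-JI = proj₁ (IsPairing.maps-to pairing j j-JI)

    αI : ∀ {j} → JI a b j → j0 ≤ κ j → JI j0 b (j0 ∨ j) × κU (j0 ∨ j) ≡ κ j
    αI {j} j-JI j0≤κj = CondI.maps-to condI j (j-JI , j0≤κj)

    βII : ∀ {j} → JI a b j → j ≤ m0 → JI a m0 j × κD j ≡ m0 ∧ κ j
    βII {j} j-JI j≤m0 = proj₂ (CondII.maps-to condII (κ j)
      (IsPairing.maps-to pairing j j-JI , j , (j-JI , refl) , j≤m0)) j (j-JI , refl)

    βII⁻¹ : ∀ {j} → JI a m0 j → JI a b j × κD j ≡ m0 ∧ κ j
    βII⁻¹ {j} j-JID with CondII.surjective condII (κD j) (IsPairing.maps-to pairingD j j-JID)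
    ... | m , (_ , j' , (j'-JI , κj'≡m) , j'≤m0) , m0∧m≡κDj = subst P j'≡j (j'-JI , κDj'≡m0∧κj')
      where
      P = λ i → JI a b i × κD i ≡ m0 ∧ κ i
      κDj'≡m0∧κj' = proj₂ (βII j'-JI j'≤m0)
      j'≡j : j' ≡ j
      j'≡j = IsPairing.injective pairingD j' j (proj₁ (βII j'-JI j'≤m0)) j-JID
        (trans κDj'≡m0∧κj' (trans (cong (m0 ∧_) κj'≡m) m0∧m≡κDj))

    ⋖-∨-j0 : ∀ {p} → InI a b p → p ≤ m0 → (p ∨ j0) ∧ m0 ≤ p → p ⋖ p ∨ j0
    ⋖-∨-j0 {p} (a≤p , p≤b) p≤m0 p∨j0∧m0≤p = (x≤x∨y , p≢p∨j0) , middle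
      where
      p≢p∨j0 : p ≢ p ∨ j0
      p≢p∨j0 eq = j0≰m0 (≤-trans y≤x∨y (≤-trans (reflexive (sym eq)) p≤m0))
      middle : ∀ w → p ≤ w → w ≤ p ∨ j0 → w ≡ p ⊎ w ≡ p ∨ j0
      middle w p≤w w≤p∨j0 with j0 ≤? w
      ... | yes j0≤w = inj₂ (antisym w≤p∨j0 (∨-least p≤w j0≤w))
      ... | no j0≰w = inj₁ (antisym (≤-trans (∧-greatest w≤p∨j0 w≤m0) p∨j0∧m0≤p) p≤w)
        where
        w≤m0 = ≤m0-unless-j0≤ (≤-trans a≤p p≤w , ≤-trans w≤p∨j0 (∨-least p≤b j0≤b)) j0≰w

    joinCover-j0 : ∀ {t} → InI a b t → t ≤ m0 → (t ∨ j0) ∧ κ j0 ⋖ t ∨ j0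
    joinCover-j0 {t} (a≤t , t≤b) t≤m0 rewrite κj0≡m0 =
      ⋖-resp-≡ refl p∨j0≡t∨j0 (⋖-∨-j0 inI-p x∧y≤y (reflexive (cong (_∧ m0) p∨j0≡t∨j0)))
      where
      p = (t ∨ j0) ∧ m0
      t≤p : t ≤ p
      t≤p = ∧-greatest x≤x∨y t≤m0
      inI-p = ≤-trans a≤t t≤p , ≤-trans x∧y≤y (proj₂ inI-m0)
      p∨j0≡t∨j0 : p ∨ j0 ≡ t ∨ j0
      p∨j0≡t∨j0 = antisym (∨-least x∧y≤x y≤x∨y) (∨-least (≤-trans t≤p x≤x∨y) y≤x∨y)

    meetCover-j0 : ∀ {t} → InI a b t → j0 ≤ t → t ∧ κ j0 ⋖ (t ∧ κ j0) ∨ j0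
    meetCover-j0 {t} (a≤t , t≤b) j0≤t rewrite κj0≡m0 =
      ⋖-∨-j0 (∧-greatest a≤t a≤m0 , ≤-trans x∧y≤x t≤b) x∧y≤y
        (∧-greatest (≤-trans x∧y≤x (∨-least x∧y≤x j0≤t)) x∧y≤y)

    coverLabelling-step : CoverLabelling upU → CoverLabelling upD → CoverLabelling up
    coverLabelling-step labelU labelD y x inI-y@(a≤y , y≤b) inI-x@(a≤x , x≤b) y⋖x
      with j0 ≤? y | j0 ≤? x
    ... | yes j0≤y | yes j0≤x with labelU y x (j0≤y , y≤b) (j0≤x , x≤b) y⋖x
    ...   | j' , j'-JI , j'≤x , y≤κUj' with CondI.surjective condI j' j'-JI
    ...     | j , (j-JI , j0≤κj) , j0∨j≡j' =
      j , j-JI , ≤-trans y≤x∨y (subst (_≤ x) (sym j0∨j≡j') j'≤x) ,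
      subst (y ≤_) (trans (cong κU (sym j0∨j≡j')) (proj₂ (αI j-JI j0≤κj))) y≤κUj'
    coverLabelling-step labelU labelD y x inI-y inI-x y⋖x | yes j0≤y | no j0≰x =
      contradiction (≤-trans j0≤y (⋖⇒≤ y⋖x)) j0≰x
    coverLabelling-step labelU labelD y x inI-y inI-x y⋖x | no j0≰y | yes j0≤x =
      j0 , j0-JI , j0≤x , subst (y ≤_) (sym κj0≡m0) (≤m0-unless-j0≤ inI-y j0≰y)
    coverLabelling-step labelU labelD y x inI-y@(a≤y , _) inI-x@(a≤x , _) y⋖x | no j0≰y | no j0≰x
      with labelD y x (a≤y , ≤m0-unless-j0≤ inI-y j0≰y) (a≤x , ≤m0-unless-j0≤ inI-x j0≰x) y⋖x
    ... | j , j-JID , j≤x , y≤κDj with βII⁻¹ j-JID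
    ...   | j-JI , κDj≡m0∧κj = j , j-JI , j≤x , ≤-trans y≤κDj (≤-trans (reflexive κDj≡m0∧κj) x∧y≤y)

    joinCover-via-upper : JoinCoverProperty upU → ∀ {j t t'} → JI a b j → j0 ≤ κ j →
      InI j0 b t' → t' ≤ κ j → t' ∨ (j0 ∨ j) ≡ t ∨ j → (t ∨ j) ∧ κ j ⋖ t ∨ j
    joinCover-via-upper joinU j-JI j0≤κj inI-t' t'≤κj t'∨j'≡t∨j =
      ⋖-resp-≡ (cong₂ _∧_ t'∨j'≡t∨j κUj'≡κj) t'∨j'≡t∨j
        (joinU _ _ j'-JI inI-t' (subst (_ ≤_) (sym κUj'≡κj) t'≤κj))
      where
      j'-JI = proj₁ (αI j-JI j0≤κj)
      κUj'≡κj = proj₂ (αI j-JI j0≤κj)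

    joinCover-step : JoinCoverProperty upU → JoinCoverProperty upD → JoinCoverProperty up
    joinCover-step joinU joinD j t j-JI inI-t@(a≤t , t≤b) t≤κj with j0 ≤? t
    ... | yes j0≤t = joinCover-via-upper joinU j-JI (≤-trans j0≤t t≤κj) (j0≤t , t≤b) t≤κj
      (antisym (∨-least x≤x∨y (∨-least (≤-trans j0≤t x≤x∨y) y≤x∨y)) (∨-least x≤x∨y (≤-trans y≤x∨y y≤x∨y)))
    ... | no j0≰t with j0 ≤? j
    ...   | no j0≰j = ⋖-resp-≡ (trans (cong ((t ∨ j) ∧_) κDj≡m0∧κj) meet-m0) refl
      (joinD j t j-JID (a≤t , t≤m0) (subst (t ≤_) (sym κDj≡m0∧κj) (∧-greatest t≤m0 t≤κj)))
      where
      t≤m0 = ≤m0-unless-j0≤ inI-t j0≰t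
      j≤m0 = ≤m0-unless-j0≤ (proj₁ j-JI) j0≰j
      j-JID = proj₁ (βII j-JI j≤m0)
      κDj≡m0∧κj = proj₂ (βII j-JI j≤m0)
      meet-m0 : (t ∨ j) ∧ (m0 ∧ κ j) ≡ (t ∨ j) ∧ κ j
      meet-m0 = antisym (∧-greatest x∧y≤x (≤-trans x∧y≤y x∧y≤y))
        (∧-greatest x∧y≤x (∧-greatest (≤-trans x∧y≤x (∨-least t≤m0 j≤m0)) x∧y≤y))
    ...   | yes j0≤j with j ≟ j0
    ...     | yes refl = joinCover-j0 inI-t (≤m0-unless-j0≤ inI-t j0≰t)
    ...     | no j≢j0 = joinCover-via-upper joinU j-JI j0≤κj (y≤x∨y , ∨-least t≤b j0≤b)
      (∨-least t≤κj j0≤κj)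
      (antisym (∨-least (∨-least x≤x∨y j0≤t∨j) (∨-least j0≤t∨j y≤x∨y))
               (∨-least (≤-trans x≤x∨y x≤x∨y) (≤-trans y≤x∨y y≤x∨y)))
      where
      j0≤κj = j0≤κ j-JI j0≤j j≢j0
      j0≤t∨j = ≤-trans j0≤j y≤x∨y

    meetCover-via-lower : MeetCoverProperty upD → ∀ {j t t'} → JI a b j → j ≤ m0 →
      InI a m0 t' → j ≤ t' → t' ∧ (m0 ∧ κ j) ≡ t ∧ κ j → t ∧ κ j ⋖ (t ∧ κ j) ∨ j
    meetCover-via-lower meetD {t' = t'} j-JI j≤m0 inI-t' j≤t' t'∧m0∧κj≡t∧κj =
      ⋖-resp-≡ t'∧κDj≡t∧κj (cong (_∨ _) t'∧κDj≡t∧κj) (meetD _ t' j-JID inI-t' j≤t')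
      where
      j-JID = proj₁ (βII j-JI j≤m0)
      t'∧κDj≡t∧κj = trans (cong (t' ∧_) (proj₂ (βII j-JI j≤m0))) t'∧m0∧κj≡t∧κj

    meetCover-step : MeetCoverProperty upU → MeetCoverProperty upD → MeetCoverProperty up
    meetCover-step meetU meetD j t j-JI inI-t@(a≤t , t≤b) j≤t with j0 ≤? t
    ... | no j0≰t = meetCover-via-lower meetD j-JI (≤-trans j≤t t≤m0) (a≤t , t≤m0) j≤t
      (antisym (∧-greatest x∧y≤x (≤-trans x∧y≤y x∧y≤y))
               (∧-greatest x∧y≤x (∧-greatest (≤-trans x∧y≤x t≤m0) x∧y≤y)))
      where
      t≤m0 = ≤m0-unless-j0≤ inI-t j0≰t
    ... | yes j0≤t with j0 ≤? κ j
    ...   | yes j0≤κj = ⋖-resp-≡ t∧κUj'≡t∧κj (trans (cong (_∨ (j0 ∨ j)) t∧κUj'≡t∧κj) absorb-j0)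
      (meetU _ t (proj₁ (αI j-JI j0≤κj)) (j0≤t , t≤b) (∨-least j0≤t j≤t))
      where
      t∧κUj'≡t∧κj = cong (t ∧_) (proj₂ (αI j-JI j0≤κj))
      j0≤t∧κj = ∧-greatest j0≤t j0≤κj
      absorb-j0 : (t ∧ κ j) ∨ (j0 ∨ j) ≡ (t ∧ κ j) ∨ j
      absorb-j0 = antisym (∨-least x≤x∨y (∨-least (≤-trans j0≤t∧κj x≤x∨y) y≤x∨y))
                          (∨-least x≤x∨y (≤-trans y≤x∨y y≤x∨y))
    ...   | no j0≰κj with j0 ≤? j
    ...     | no j0≰j = meetCover-via-lower meetD j-JI j≤m0 (∧-greatest a≤t a≤m0 , x∧y≤y)
      (∧-greatest j≤t j≤m0)
      (antisym (∧-greatest (≤-trans x∧y≤x x∧y≤x) (≤-trans x∧y≤y x∧y≤y))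
               (∧-greatest (∧-greatest x∧y≤x (≤-trans x∧y≤y κj≤m0)) (∧-greatest (≤-trans x∧y≤y κj≤m0) x∧y≤y)))
      where
      j≤m0 = ≤m0-unless-j0≤ (proj₁ j-JI) j0≰j
      κj≤m0 = ≤m0-unless-j0≤ (κ-inI j-JI) j0≰κj
    ...     | yes j0≤j with j ≟ j0
    ...       | yes refl = meetCover-j0 inI-t j0≤t
    ...       | no j≢j0 = contradiction (j0≤κ j-JI j0≤j j≢j0) j0≰κj

  coverLabelling : ∀ {a b up} → CD a b up → CoverLabelling up
  coverLabelling (single _ a≡b) y x inI-y inI-x y⋖x = contradiction (inI-degenerate a≡b inI-y inI-x) (⋖⇒≢ y⋖x)
  coverLabelling (dismantle up j0 m0 pp upU cdU upD cdD condI condII) =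
    PrimePairSplit.coverLabelling-step up j0 m0 pp upU upD condI condII (coverLabelling cdU) (coverLabelling cdD)

  joinCover : ∀ {a b up} → CD a b up → JoinCoverProperty up
  joinCover (single _ a≡b) j t j-JI = ⊥-elim (no-JI-in-point a≡b j-JI)
  joinCover (dismantle up j0 m0 pp upU cdU upD cdD condI condII) =
    PrimePairSplit.joinCover-step up j0 m0 pp upU upD condI condII (joinCover cdU) (joinCover cdD)

  meetCover : ∀ {a b up} → CD a b up → MeetCoverProperty up
  meetCover (single _ a≡b) j t j-JI = ⊥-elim (no-JI-in-point a≡b j-JI)
  meetCover (dismantle up j0 m0 pp upU cdU upD cdD condI condII) =
    PrimePairSplit.meetCover-step up j0 m0 pp upU upD condI condII (meetCover cdU) (meetCover cdD)

  -- Semidistrim lattices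

  module SemidistrimTheory (sd : Semidistrim) where
    open Semidistrim sd using (up; cd; 𝓓-indep; 𝓤-indep)
    private
      κ = UniquelyPaired.κ up
    open WithPairing κ

    j≰κ : ∀ {j} → 𝓙 j → ¬ j ≤ κ j
    j≰κ = j≰κj (UniquelyPaired.isPairing up)

    label : ∀ {y x} → y ⋖ x → ∃ λ j → 𝓙 j × j ≤ x × y ≤ κ j
    label {y} {x} = coverLabelling cd y x (inI-⊥⊤ y) (inI-⊥⊤ x)

    𝓓-intro : ∀ {y x j} → y ⋖ x → 𝓙 j → j ≤ x → y ≤ κ j → 𝓓 x j
    𝓓-intro y⋖x j-J j≤x y≤κj = _ , y⋖x , (j-J , y≤κj) , (j-J , j≤x)

    𝓤-intro : ∀ {x y j} → x ⋖ y → 𝓙 j → j ≤ y → x ≤ κ j → 𝓤 x j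
    𝓤-intro x⋖y j-J j≤y x≤κj = _ , x⋖y , (j-J , x≤κj) , (j-J , j≤y)

    𝓓⇒𝓙 : ∀ {x j} → 𝓓 x j → 𝓙 j
    𝓓⇒𝓙 (_ , _ , _ , (j-J , _)) = j-J

    𝓓⇒≤ : ∀ {x j} → 𝓓 x j → j ≤ x
    𝓓⇒≤ (_ , _ , _ , (_ , j≤x)) = j≤x

    𝓤⇒𝓙 : ∀ {x j} → 𝓤 x j → 𝓙 j
    𝓤⇒𝓙 (_ , _ , (j-J , _) , _) = j-J

    𝓤⇒≤κ : ∀ {x j} → 𝓤 x j → x ≤ κ j
    𝓤⇒≤κ (_ , _ , (_ , x≤κj) , _) = x≤κj

    independent⇒≤κ : ∀ {S j l} → Independent S → S j → S l → 𝓙 j → 𝓙 l → j ≢ l → j ≤ κ l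
    independent⇒≤κ {j = j} {l} independent Sj Sl j-J l-J j≢l with j ≤? κ l
    ... | yes j≤κl = j≤κl
    ... | no j≰κl = ⊥-elim (independent j l Sj Sl (j-J , l-J , j≢l , j≰κl))

    ≤-by-𝓤 : ∀ {v w} → (∀ j → 𝓤 w j → v ≤ κ j) → v ≤ w
    ≤-by-𝓤 {v} {w} v≤κ𝓤w with v ≤? w
    ... | yes v≤w = v≤w
    ... | no v≰w with upperCover-below (≰⇒<∨ v≰w)
    ...   | c , w⋖c , c≤v∨w with label w⋖c
    ...     | j , j-J , j≤c , w≤κj = ⊥-elim (j≰κ j-J
              (≤-trans j≤c (≤-trans c≤v∨w (∨-least (v≤κ𝓤w j (𝓤-intro w⋖c j-J j≤c w≤κj)) w≤κj))))

    ≤-by-𝓓 : ∀ {w v} → (∀ j → 𝓓 w j → j ≤ v) → w ≤ v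
    ≤-by-𝓓 {w} {v} 𝓓w≤v with w ≤? v
    ... | yes w≤v = w≤v
    ... | no w≰v with lowerCover-above (≰⇒∧< w≰v)
    ...   | y , w∧v≤y , y⋖w with label y⋖w
    ...     | j , j-J , j≤w , y≤κj = ⊥-elim (j≰κ j-J
              (≤-trans (∧-greatest j≤w (𝓓w≤v j (𝓓-intro y⋖w j-J j≤w y≤κj))) (≤-trans w∧v≤y y≤κj)))

    Pop↓-≤-κ𝓓 : ∀ {x a} → 𝓓 x a → Pop↓ x ≤ κ a
    Pop↓-≤-κ𝓓 (_ , y⋖x , (_ , y≤κa) , _) = ≤-trans (Pop↓-≤-lowerCover y⋖x) y≤κa

    ≤-Pop↓ : ∀ {x v} → v ≤ x → (∀ a → 𝓓 x a → v ≤ κ a) → v ≤ Pop↓ x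
    ≤-Pop↓ v≤x v≤κ𝓓x = Pop↓-greatest v≤x v≤lowerCover
      where
      v≤lowerCover : ∀ y → y ⋖ _ → _ ≤ y
      v≤lowerCover y y⋖x with label y⋖x
      ... | a , a-J , a≤x , y≤κa = subst (_ ≤_) (⋖-meet y⋖x y≤κa (j≰κ a-J ∘ ≤-trans a≤x))
        (∧-greatest v≤x (v≤κ𝓓x a (𝓓-intro y⋖x a-J a≤x y≤κa)))

    𝓤-≤-Pop↑ : ∀ {v a} → 𝓤 v a → a ≤ Pop↑ v
    𝓤-≤-Pop↑ (_ , v⋖c , _ , (_ , a≤c)) = ≤-trans a≤c (upperCover-≤-Pop↑ v⋖c)

    Pop↑-≤ : ∀ {v w} → v ≤ w → (∀ a → 𝓤 v a → a ≤ w) → Pop↑ v ≤ w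
    Pop↑-≤ v≤w 𝓤v≤w = Pop↑-least v≤w upperCover≤w
      where
      upperCover≤w : ∀ c → _ ⋖ c → c ≤ _
      upperCover≤w c v⋖c with label v⋖c
      ... | a , a-J , a≤c , v≤κa = subst (_≤ _) (⋖-join v⋖c a≤c (j≰κ a-J ∘ flip ≤-trans v≤κa))
        (∨-least v≤w (𝓤v≤w a (𝓤-intro v⋖c a-J a≤c v≤κa)))

    𝓓-label-unique : ∀ {y s j l} → y ⋖ s → 𝓓 s j → 𝓓 s l → y ≤ κ l → ¬ j ≤ y → l ≡ j
    𝓓-label-unique {y} {s} {j} {l} y⋖s 𝓓sj 𝓓sl y≤κl j≰y with l ≟ j
    ... | yes l≡j = l≡j
    ... | no l≢j = ⊥-elim (j≰κ (𝓓⇒𝓙 𝓓sl) (≤-trans (𝓓⇒≤ 𝓓sl) s≤κl))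
      where
      j≤κl = independent⇒≤κ (𝓓-indep s) 𝓓sj 𝓓sl (𝓓⇒𝓙 𝓓sj) (𝓓⇒𝓙 𝓓sl) (l≢j ∘ sym)
      s≤κl = subst (_≤ κ l) (⋖-join y⋖s (𝓓⇒≤ 𝓓sj) j≰y) (∨-least y≤κl j≤κl)

    𝓤-label-unique : ∀ {r c j l} → r ⋖ c → 𝓤 r j → 𝓤 r l → l ≤ c → ¬ c ≤ κ j → l ≡ j
    𝓤-label-unique {r} {c} {j} {l} r⋖c 𝓤rj 𝓤rl l≤c c≰κj with l ≟ j
    ... | yes l≡j = l≡j
    ... | no l≢j = ⊥-elim (j≰κ (𝓤⇒𝓙 𝓤rl) (≤-trans l≤r (𝓤⇒≤κ 𝓤rl)))
      where
      l≤κj = independent⇒≤κ (𝓤-indep r) 𝓤rl 𝓤rj (𝓤⇒𝓙 𝓤rl) (𝓤⇒𝓙 𝓤rj) l≢j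
      l≤r = subst (l ≤_) (⋖-meet r⋖c (𝓤⇒≤κ 𝓤rj) c≰κj) (∧-greatest l≤c l≤κj)

    -- Pop↓ x ⋖ Pop↓ x ∨ j, because any lower cover y of Pop↓ x ∨ j above Pop↓ x has label j,
    -- and then y satisfies the bounds characterising Pop↓ x.
    𝓓⊆𝓤∘Pop↓ : ∀ {x j} → 𝓓 x j → 𝓤 (Pop↓ x) j
    𝓓⊆𝓤∘Pop↓ {x} {j} 𝓓xj = 𝓤-intro z⋖s j-J y≤x∨y z≤κj
      where
      z = Pop↓ x
      s = z ∨ j
      j-J = 𝓓⇒𝓙 𝓓xj
      z≤κj = Pop↓-≤-κ𝓓 𝓓xj
      𝓓sj : 𝓓 s j
      𝓓sj = 𝓓-intro (joinCover cd j z j-J (inI-⊥⊤ z) z≤κj) j-J y≤x∨y x∧y≤y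
      s≤κ : ∀ a → 𝓓 x a → a ≢ j → s ≤ κ a
      s≤κ a 𝓓xa a≢j = ∨-least (Pop↓-≤-κ𝓓 𝓓xa)
        (independent⇒≤κ (𝓓-indep x) 𝓓xj 𝓓xa j-J (𝓓⇒𝓙 𝓓xa) (a≢j ∘ sym))
      z⋖s : z ⋖ s
      z⋖s = ⋖-by-lowerCovers (x≤x∨y , λ z≡s → j≰κ j-J (≤-trans y≤x∨y (subst (_≤ κ j) z≡s z≤κj))) y≤z
        where
        y≤z : ∀ y → z ≤ y → y ⋖ s → y ≤ z
        y≤z y z≤y y⋖s with label y⋖s
        ... | l , l-J , l≤s , y≤κl = ≤-Pop↓ (≤-trans (⋖⇒≤ y⋖s) (∨-least Pop↓-≤ (𝓓⇒≤ 𝓓xj))) y≤κ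
          where
          j≰y : ¬ j ≤ y
          j≰y j≤y = ⋖⇒≢ y⋖s (antisym (⋖⇒≤ y⋖s) (∨-least z≤y j≤y))
          l≡j = 𝓓-label-unique y⋖s 𝓓sj (𝓓-intro y⋖s l-J l≤s y≤κl) y≤κl j≰y
          y≤κ : ∀ a → 𝓓 x a → y ≤ κ a
          y≤κ a 𝓓xa with a ≟ j
          ... | yes refl = subst (λ i → y ≤ κ i) l≡j y≤κl
          ... | no a≢j = ≤-trans (⋖⇒≤ y⋖s) (s≤κ a 𝓓xa a≢j)

    𝓤⊆𝓓∘Pop↑ : ∀ {v j} → 𝓤 v j → 𝓓 (Pop↑ v) j
    𝓤⊆𝓓∘Pop↑ {v} {j} 𝓤vj = 𝓓-intro r⋖u j-J j≤u x∧y≤y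
      where
      u = Pop↑ v
      r = u ∧ κ j
      j-J = 𝓤⇒𝓙 𝓤vj
      j≤u = 𝓤-≤-Pop↑ 𝓤vj
      𝓤rj : 𝓤 r j
      𝓤rj = 𝓤-intro (meetCover cd j u j-J (inI-⊥⊤ u) j≤u) j-J y≤x∨y x∧y≤y
      ≤r : ∀ a → 𝓤 v a → a ≢ j → a ≤ r
      ≤r a 𝓤va a≢j = ∧-greatest (𝓤-≤-Pop↑ 𝓤va)
        (independent⇒≤κ (𝓤-indep v) 𝓤va 𝓤vj (𝓤⇒𝓙 𝓤va) j-J a≢j)
      r⋖u : r ⋖ u
      r⋖u = ⋖-by-upperCovers (x∧y≤x , λ r≡u → j≰κ j-J (≤-trans j≤u (subst (_≤ κ j) r≡u x∧y≤y))) u≤c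
        where
        u≤c : ∀ c → r ⋖ c → c ≤ u → u ≤ c
        u≤c c r⋖c c≤u with label r⋖c
        ... | l , l-J , l≤c , r≤κl = Pop↑-≤ (≤-trans (∧-greatest ≤-Pop↑ (𝓤⇒≤κ 𝓤vj)) (⋖⇒≤ r⋖c)) ≤c
          where
          c≰κj : ¬ c ≤ κ j
          c≰κj c≤κj = ⋖⇒≢ r⋖c (antisym (⋖⇒≤ r⋖c) (∧-greatest c≤u c≤κj))
          l≡j = 𝓤-label-unique r⋖c 𝓤rj (𝓤-intro r⋖c l-J l≤c r≤κl) l≤c c≰κj
          ≤c : ∀ a → 𝓤 v a → a ≤ c
          ≤c a 𝓤va with a ≟ j
          ... | yes refl = subst (_≤ c) l≡j l≤c
          ... | no a≢j = ≤-trans (≤r a 𝓤va a≢j) (⋖⇒≤ r⋖c)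

    module Rowmotion (Row : C → C) (isRow : IsRowmotion sd Row) where
      𝓤Row⇒𝓓 : ∀ {x j} → 𝓤 (Row x) j → 𝓓 x j
      𝓤Row⇒𝓓 {x} {j} = proj₁ (isRow x j)

      𝓓⇒𝓤Row : ∀ {x j} → 𝓓 x j → 𝓤 (Row x) j
      𝓓⇒𝓤Row {x} {j} = proj₂ (isRow x j)

      Row-injective : Injective _≡_ _≡_ Row
      Row-injective Rx≡Rx' = antisym (Row≡⇒≤ Rx≡Rx') (Row≡⇒≤ (sym Rx≡Rx'))
        where
        Row≡⇒≤ : ∀ {x x'} → Row x ≡ Row x' → x ≤ x'
        Row≡⇒≤ Rx≡Rx' = ≤-by-𝓓 λ j 𝓓xj → 𝓓⇒≤ (𝓤Row⇒𝓓 (subst (λ w → 𝓤 w j) Rx≡Rx' (𝓓⇒𝓤Row 𝓓xj)))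

      Row⁻¹ : C → C
      Row⁻¹ z = proj₁ (injective⇒surjective Row Row-injective z)

      Row-Row⁻¹ : ∀ z → Row (Row⁻¹ z) ≡ z
      Row-Row⁻¹ z = proj₂ (injective⇒surjective Row Row-injective z)

      Row≤⇒Pop↓≡Row : ∀ {x} → Row x ≤ x → Pop↓ x ≡ Row x
      Row≤⇒Pop↓≡Row Rx≤x = antisym
        (≤-by-𝓤 λ j 𝓤Rxj → Pop↓-≤-κ𝓓 (𝓤Row⇒𝓓 𝓤Rxj))
        (≤-Pop↓ Rx≤x λ a 𝓓xa → 𝓤⇒≤κ (𝓓⇒𝓤Row 𝓓xa))

      Row≤⇒Pop↑Row≡ : ∀ {x} → Row x ≤ x → Pop↑ (Row x) ≡ x
      Row≤⇒Pop↑Row≡ Rx≤x = antisym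
        (Pop↑-≤ Rx≤x λ a 𝓤Rxa → 𝓓⇒≤ (𝓤Row⇒𝓓 𝓤Rxa))
        (≤-by-𝓓 λ j 𝓓xj → 𝓤-≤-Pop↑ (𝓓⇒𝓤Row 𝓓xj))

      Row≡Pop↓⇒≤ : ∀ {w x} → Row w ≡ Pop↓ x → x ≤ w
      Row≡Pop↓⇒≤ Rw≡Pop↓x = ≤-by-𝓓 λ j 𝓓xj →
        𝓓⇒≤ (𝓤Row⇒𝓓 (subst (λ z → 𝓤 z j) (sym Rw≡Pop↓x) (𝓓⊆𝓤∘Pop↓ 𝓓xj)))

      Row-Pop↑≤ : ∀ {v} → Row (Pop↑ v) ≤ Pop↑ v
      Row-Pop↑≤ = ≤-trans (≤-by-𝓤 λ j 𝓤vj → 𝓤⇒≤κ (𝓓⇒𝓤Row (𝓤⊆𝓓∘Pop↑ 𝓤vj))) ≤-Pop↑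

      Row≤-count≡Pop↓ : count (λ x → Row x ≤? x) ≡ imageSize Pop↓
      Row≤-count≡Pop↓ = ℕ.≤-antisym
        (countFin-≤-injection _ _ Row (λ Rx≤x → _ , Row≤⇒Pop↓≡Row Rx≤x) (λ _ _ → Row-injective))
        (countFin-≤-injection _ _ Row⁻¹ Row⁻¹-descends λ _ _ eq →
          trans (sym (Row-Row⁻¹ _)) (trans (cong Row eq) (Row-Row⁻¹ _)))
        where
        Row⁻¹-descends : ∀ {z} → (∃ λ x → Pop↓ x ≡ z) → Row (Row⁻¹ z) ≤ Row⁻¹ z
        Row⁻¹-descends {z} (x , Pop↓x≡z) = ≤-trans (subst (_≤ x) (sym Rw≡Pop↓x) Pop↓-≤) (Row≡Pop↓⇒≤ Rw≡Pop↓x)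
          where
          Rw≡Pop↓x = trans (Row-Row⁻¹ z) (sym Pop↓x≡z)

      Row≤-count≡Pop↑ : count (λ x → Row x ≤? x) ≡ imageSize Pop↑
      Row≤-count≡Pop↑ = countFin-cong _ _
        ( (λ {x} Rx≤x → Row x , Row≤⇒Pop↑Row≡ Rx≤x)
        , (λ { (v , refl) → Row-Pop↑≤ }) )

corollary9p10 : (L : FinLattice) (sd : FL.Semidistrim L)
    (Row : FL.C L → FL.C L) → FL.IsRowmotion L sd Row →
    FL.count L (λ x → FL._≤?_ L (Row x) x) ≡ FL.imageSize L (FL.Pop↓ L)
    × FL.imageSize L (FL.Pop↓ L) ≡ FL.imageSize L (FL.Pop↑ L)
corollary9p10 L sd Row isRow = Row≤-count≡Pop↓ , trans (sym Row≤-count≡Pop↓) Row≤-count≡Pop↑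
  where open LatticeTheory.SemidistrimTheory.Rowmotion L sd Row isRow
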